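{- Let $m\ge 2$, let $\mathbf d=(d_1,\dots,d_m)$ be positive integers and let $\boldsymbol\delta=(\delta_1,\dots,\delta_m)$ be positive integers such that $\gcd(\delta_i,d_i)=1$ for every $i$ and $\delta_i d_j\neq \delta_j d_i$ for all $i\neq j$. For $1\le i\le m$ define $\mathbf d_i=(d_{i,1},\dots,d_{i,m})$ by $d_{i,i}=d_i$ and $d_{i,j}=\delta_i d_j-\delta_j d_i$ for $j\neq i$. Then $$\pi(\mathbf d)\sum_{i=1}^m\frac{\delta_i^{m-1}}{\pi(\mathbf d_i)}=1,\qquad \frac{\pi(\mathbf d)}{\sigma_1(\mathbf d)}\sum_{i=1}^m\frac{\delta_i^{m-2}\sigma_1(\mathbf d_i)}{\pi(\mathbf d_i)}=1 .$$
   Context: For a vector $\mathbf e=(e_1,\dots,e_m)$ of integers, $\pi(\mathbf e)=\prod_i e_i$ and $\sigma_1(\mathbf e)=\sum_i e_i$. -}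

module Defs where

open import Data.Nat as ℕ using (ℕ; zero; suc)
open import Data.Integer as ℤ using (ℤ; +_)
open import Data.Rational as ℚ using (ℚ; 0ℚ; 1ℚ)
open import Data.Rational.Properties using (_≟_)
open import Data.Fin using (Fin)
import Data.Fin as Fin
open import Relation.Nullary using (yes; no)

sumℤ : ∀ {m} → (Fin m → ℤ) → ℤ
sumℤ {zero}  v = + 0
sumℤ {suc m} v = v Fin.zero ℤ.+ sumℤ (λ i → v (Fin.suc i))

prodℤ : ∀ {m} → (Fin m → ℤ) → ℤ
prodℤ {zero}  v = + 1
prodℤ {suc m} v = v Fin.zero ℤ.* prodℤ (λ i → v (Fin.suc i))

π : ∀ {m} → (Fin m → ℤ) → ℤ
π = prodℤ

σ₁ : ∀ {m} → (Fin m → ℤ) → ℤ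
σ₁ = sumℤ

sumℚ : ∀ {m} → (Fin m → ℚ) → ℚ
sumℚ {zero}  v = 0ℚ
sumℚ {suc m} v = v Fin.zero ℚ.+ sumℚ (λ i → v (Fin.suc i))

toℚ : ℤ → ℚ
toℚ z = z ℚ./ 1

-- total inverse (inv 0 = 0); only applied to nonzero arguments in the theorem
inv : ℚ → ℚ
inv p with p ≟ 0ℚ
... | yes _ = 0ℚ
... | no p≢0 = ℚ.1/_ p {{ℚ.≢-nonZero p≢0}}

dRow : ∀ {m} → (d δ : Fin m → ℕ) → Fin m → Fin m → ℤ
dRow d δ i j with i Fin.≟ j
... | yes _ = + d i
... | no _  = (+ (δ i ℕ.* d j)) ℤ.- (+ (δ j ℕ.* d i))

{-# OPTIONS --safe #-}
module Submission where

-- With pᵢ = (δᵢ , dᵢ) ∈ ℚ² and det (x , y) (x′ , y′) = x y′ - x′ y, the entries of dᵢ off the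
-- diagonal are det pᵢ pⱼ, so π(dᵢ) = dᵢ ∏_{j≠i} det pᵢ pⱼ. The core is a homogeneous Lagrange
-- interpolation identity: for n + 2 pairwise independent points, ∑ᵢ xᵢⁿ / ∏_{j≠i} det pᵢ pⱼ = 0.
-- It follows by induction on n: split off two points c and a; the relation
-- x_y det a c = x_a det y c - x_c det y a gives a partial fraction decomposition of the remaining
-- terms into the two sums for n with a resp. c removed. Adjoining the point (1 , 0), for which
-- det (1 , 0) pᵢ = dᵢ, turns the identity into the first formula. Since
-- σ₁(dᵢ) = dᵢ + δᵢ σ₁(d) - dᵢ σ₁(δ), the second sum is σ₁(d) times the first one plus
-- (1 - σ₁(δ)) times a Lagrange sum of exponent m - 2, which vanishes.

open import Defs

module Lagrange where

  open import Data.Nat as ℕ using (ℕ; zero; suc)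
  open import Data.Integer as ℤ using (ℤ; +_)
  import Data.Integer.Properties as ℤ
  open import Data.Rational as ℚ using (ℚ; 0ℚ; 1ℚ; mkℚ; _+_; _*_; -_; _-_; Positive; ≢-nonZero)
  open import Data.Rational.Properties
  open import Data.Rational.Solver using (module +-*-Solver)
  open +-*-Solver using (solve; _:=_; _:+_; _:*_; :-_; _:-_; con)
  import Data.Nat.Coprimality as Coprimality
  open import Data.Fin as Fin using (Fin; zero; suc; punchIn)
  open import Data.Fin.Properties using (punchIn-injective; punchInᵢ≢i)
  open import Data.Vec.Functional using (_∷_; removeAt)
  open import Data.Product using (_×_; _,_; proj₁; proj₂)
  open import Function using (_∘_)
  open import Relation.Binary.PropositionalEquality
  open import Relation.Nullary using (Dec; yes; no; contradiction)
  open import Algebra.Bundles using (CommutativeRing)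
  open import Algebra.Properties.Semiring.Sum (CommutativeRing.semiring +-*-commutativeRing)
    using (sum; sum-remove; sum-cong-≗; ∑-distrib-+; *-distribˡ-sum)
  open import Algebra.Properties.Semiring.Exp (CommutativeRing.semiring +-*-commutativeRing)
    using (_^_)
  open import Algebra.Properties.CommutativeMonoid.Sum *-1-commutativeMonoid
    using () renaming (sum to product; sum-remove to product-remove; sum-cong-≗ to product-cong-≗)
  open import Algebra.Properties.Group +-0-group using (inverseˡ-unique; inverseʳ-unique)
  open ≡-Reasoning

  inv-inverseʳ : ∀ {x} → x ≢ 0ℚ → x * inv x ≡ 1ℚ
  inv-inverseʳ {x} x≢0 with x ≟ 0ℚ
  ... | yes x≡0 = contradiction x≡0 x≢0
  ... | no x≢0′ = *-inverseʳ x {{≢-nonZero x≢0′}}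

  inv-unique : ∀ {x y} → x * y ≡ 1ℚ → inv x ≡ y
  inv-unique {x} {y} xy≡1 = begin
    inv x            ≡⟨ *-identityʳ (inv x) ⟨
    inv x * 1ℚ       ≡⟨ cong (inv x *_) xy≡1 ⟨
    inv x * (x * y)  ≡⟨ solve 3 (λ x y i → i :* (x :* y) := (x :* i) :* y) refl x y (inv x) ⟩
    (x * inv x) * y  ≡⟨ cong (_* y) (inv-inverseʳ x≢0) ⟩
    1ℚ * y           ≡⟨ *-identityˡ y ⟩
    y                ∎
    where
    x≢0 : x ≢ 0ℚ
    x≢0 refl = 1≢0 (trans (sym xy≡1) (*-zeroˡ y))

  -- No side conditions: inv 0ℚ = 0ℚ.
  inv-distrib-* : ∀ x y → inv (x * y) ≡ inv x * inv y
  inv-distrib-* x y = by-cases (x ≟ 0ℚ) (y ≟ 0ℚ)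
    where
    by-cases : Dec (x ≡ 0ℚ) → Dec (y ≡ 0ℚ) → inv (x * y) ≡ inv x * inv y
    by-cases (yes refl) _        = trans (cong inv (*-zeroˡ y)) (sym (*-zeroˡ (inv y)))
    by-cases (no _)     (yes refl) = trans (cong inv (*-zeroʳ x)) (sym (*-zeroʳ (inv x)))
    by-cases (no x≢0)   (no y≢0) = inv-unique {x = x * y} (begin
      (x * y) * (inv x * inv y)
        ≡⟨ solve 4 (λ x y i j → (x :* y) :* (i :* j) := (x :* i) :* (y :* j)) refl x y (inv x) (inv y) ⟩
      (x * inv x) * (y * inv y)  ≡⟨ cong₂ _*_ (inv-inverseʳ x≢0) (inv-inverseʳ y≢0) ⟩
      1ℚ                         ∎)

  inv-neg : ∀ x → inv (- x) ≡ - inv x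
  inv-neg x = by-cases (x ≟ 0ℚ)
    where
    by-cases : Dec (x ≡ 0ℚ) → inv (- x) ≡ - inv x
    by-cases (yes refl) = refl
    by-cases (no x≢0)   = inv-unique {x = - x} (begin
      - x * - inv x  ≡⟨ solve 2 (λ x i → (:- x) :* (:- i) := x :* i) refl x (inv x) ⟩
      x * inv x      ≡⟨ inv-inverseʳ x≢0 ⟩
      1ℚ             ∎)

  -- toℚ z = z / 1 normalises through a gcd and so is stuck for a variable z;
  -- mkℚ z 0 is not, and ℚ's _+_ and _*_ compute on it.
  toℚ≡mkℚ : ∀ z → toℚ z ≡ mkℚ z 0 (Coprimality.sym (Coprimality.1-coprimeTo _))
  toℚ≡mkℚ z = ↥p/↧p≡p (mkℚ z 0 _)

  toℚ-injective : ∀ {a b} → toℚ a ≡ toℚ b → a ≡ b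
  toℚ-injective {a} {b} eq = cong ℚ.↥_ (trans (sym (toℚ≡mkℚ a)) (trans eq (toℚ≡mkℚ b)))

  toℚ-* : ∀ a b → toℚ (a ℤ.* b) ≡ toℚ a * toℚ b
  toℚ-* a b = sym (cong₂ _*_ (toℚ≡mkℚ a) (toℚ≡mkℚ b))

  toℚ-+ : ∀ a b → toℚ (a ℤ.+ b) ≡ toℚ a + toℚ b
  toℚ-+ a b = begin
    toℚ (a ℤ.+ b)                  ≡⟨ cong₂ (λ a′ b′ → toℚ (a′ ℤ.+ b′)) (ℤ.*-identityʳ a) (ℤ.*-identityʳ b) ⟨
    toℚ (a ℤ.* + 1 ℤ.+ b ℤ.* + 1)  ≡⟨ cong₂ _+_ (toℚ≡mkℚ a) (toℚ≡mkℚ b) ⟨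
    toℚ a + toℚ b                  ∎

  toℚ-neg : ∀ z → toℚ (ℤ.- z) ≡ - toℚ z
  toℚ-neg z = inverseˡ-unique (toℚ (ℤ.- z)) (toℚ z) (begin
    toℚ (ℤ.- z) + toℚ z  ≡⟨ toℚ-+ (ℤ.- z) z ⟨
    toℚ (ℤ.- z ℤ.+ z)    ≡⟨ cong toℚ (ℤ.+-inverseˡ z) ⟩
    0ℚ                   ∎)

  toℚ-- : ∀ a b → toℚ (a ℤ.- b) ≡ toℚ a - toℚ b
  toℚ-- a b = trans (toℚ-+ a (ℤ.- b)) (cong (_+_ (toℚ a)) (toℚ-neg b))

  toℚ-+* : ∀ m n → toℚ (+ (m ℕ.* n)) ≡ toℚ (+ m) * toℚ (+ n)
  toℚ-+* m n = trans (cong toℚ (ℤ.pos-* m n)) (toℚ-* (+ m) (+ n))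

  toℚ-+^ : ∀ m k → toℚ (+ (m ℕ.^ k)) ≡ toℚ (+ m) ^ k
  toℚ-+^ m zero    = refl
  toℚ-+^ m (suc k) = trans (toℚ-+* m (m ℕ.^ k)) (cong (toℚ (+ m) *_) (toℚ-+^ m k))

  toℚ-sumℤ : ∀ {n} (v : Fin n → ℤ) → toℚ (sumℤ v) ≡ sum (toℚ ∘ v)
  toℚ-sumℤ {zero}  v = refl
  toℚ-sumℤ {suc n} v = trans (toℚ-+ (v zero) _) (cong (_+_ (toℚ (v zero))) (toℚ-sumℤ (v ∘ suc)))

  toℚ-prodℤ : ∀ {n} (v : Fin n → ℤ) → toℚ (prodℤ v) ≡ product (toℚ ∘ v)
  toℚ-prodℤ {zero}  v = refl
  toℚ-prodℤ {suc n} v = trans (toℚ-* (v zero) _) (cong (toℚ (v zero) *_) (toℚ-prodℤ (v ∘ suc)))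

  sumℚ≡sum-cong : ∀ {n} {f g : Fin n → ℚ} → (∀ i → f i ≡ g i) → sumℚ f ≡ sum g
  sumℚ≡sum-cong {zero}  f≗g = refl
  sumℚ≡sum-cong {suc n} f≗g = cong₂ _+_ (f≗g zero) (sumℚ≡sum-cong (f≗g ∘ suc))

  sum-linear : ∀ {n} α β (f g : Fin n → ℚ) → sum (λ i → α * f i + β * g i) ≡ α * sum f + β * sum g
  sum-linear α β f g = trans (∑-distrib-+ (λ i → α * f i) (λ i → β * g i))
    (sym (cong₂ _+_ (*-distribˡ-sum α f) (*-distribˡ-sum β g)))

  Point : Set
  Point = ℚ × ℚ

  det : Point → Point → ℚ
  det (x₁ , y₁) (x₂ , y₂) = x₁ * y₂ - x₂ * y₁

  det-antisym : ∀ p q → det q p ≡ - det p q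
  det-antisym (x₁ , y₁) (x₂ , y₂) =
    solve 4 (λ x₁ y₁ x₂ y₂ → x₂ :* y₁ :- x₁ :* y₂ := :- (x₁ :* y₂ :- x₂ :* y₁)) refl x₁ y₁ x₂ y₂

  plücker : ∀ a b c → proj₁ a * det b c ≡ proj₁ b * det a c - proj₁ c * det a b
  plücker (x₁ , y₁) (x₂ , y₂) (x₃ , y₃) =
    solve 6 (λ x₁ y₁ x₂ y₂ x₃ y₃ → x₁ :* (x₂ :* y₃ :- x₃ :* y₂)
                                   := x₂ :* (x₁ :* y₃ :- x₃ :* y₁) :- x₃ :* (x₁ :* y₂ :- x₂ :* y₁))
            refl x₁ y₁ x₂ y₂ x₃ y₃

  PairwiseIndependent : ∀ {n} → (Fin n → Point) → Set
  PairwiseIndependent p = ∀ i j → i ≢ j → det (p i) (p j) ≢ 0ℚ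

  removeAt-independent : ∀ {n} {p : Fin (suc n) → Point} → PairwiseIndependent p →
                         ∀ k → PairwiseIndependent (removeAt p k)
  removeAt-independent indep k i j i≢j = indep (punchIn k i) (punchIn k j) (i≢j ∘ punchIn-injective k i j)

  ∷-independent : ∀ {n q} {p : Fin n → Point} → (∀ j → det q (p j) ≢ 0ℚ) → PairwiseIndependent p →
                  PairwiseIndependent (q ∷ p)
  ∷-independent q⊥p indep zero    zero    0≢0 = contradiction refl 0≢0
  ∷-independent q⊥p indep zero    (suc j) _   = q⊥p j
  ∷-independent {q = q} {p} q⊥p indep (suc i) zero _ = q⊥p i ∘ neg-injective ∘ trans (sym (det-antisym q (p i)))
  ∷-independent q⊥p indep (suc i) (suc j) i≢j = indep i j (i≢j ∘ cong suc)

  vandermonde : ∀ {n} → (Fin (suc n) → Point) → Fin (suc n) → ℚ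
  vandermonde p i = product (removeAt (det (p i) ∘ p) i)

  partial-fractions : ∀ {x u v b c s} → b ≢ 0ℚ → c ≢ 0ℚ → s ≢ 0ℚ → x * s ≡ u * b - v * c →
                      x * inv (b * c) ≡ inv s * (u * inv c - v * inv b)
  partial-fractions {x} {u} {v} {b} {c} {s} b≢0 c≢0 s≢0 eq = begin
    x * inv (b * c)                                         ≡⟨ cong (x *_) (inv-distrib-* b c) ⟩
    x * (inv b * inv c)                                     ≡⟨ *-identityʳ _ ⟨
    x * (inv b * inv c) * 1ℚ                                ≡⟨ cong (x * (inv b * inv c) *_) (inv-inverseʳ s≢0) ⟨
    x * (inv b * inv c) * (s * inv s)
      ≡⟨ solve 5 (λ x s i j k → x :* (i :* j) :* (s :* k) := (x :* s) :* (k :* i :* j))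
               refl x s (inv b) (inv c) (inv s) ⟩
    (x * s) * (inv s * inv b * inv c)                       ≡⟨ cong (_* (inv s * inv b * inv c)) eq ⟩
    (u * b - v * c) * (inv s * inv b * inv c)
      ≡⟨ solve 7 (λ u v b c i j k → (u :* b :- v :* c) :* (k :* i :* j)
                                    := k :* (u :* j :* (b :* i) :- v :* i :* (c :* j)))
               refl u v b c (inv b) (inv c) (inv s) ⟩
    inv s * (u * inv c * (b * inv b) - v * inv b * (c * inv c))
      ≡⟨ cong₂ (λ β γ → inv s * (u * inv c * β - v * inv b * γ)) (inv-inverseʳ b≢0) (inv-inverseʳ c≢0) ⟩
    inv s * (u * inv c * 1ℚ - v * inv b * 1ℚ)
      ≡⟨ cong₂ (λ β γ → inv s * (β - γ)) (*-identityʳ (u * inv c)) (*-identityʳ (v * inv b)) ⟩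
    inv s * (u * inv c - v * inv b)                         ∎

  module LagrangeStep {n} (ih : ∀ (q : Fin (suc (suc n)) → Point) → PairwiseIndependent q →
                                sum (λ i → proj₁ (q i) ^ n * inv (vandermonde q i)) ≡ 0ℚ)
                      (p : Fin (suc (suc (suc n))) → Point) (indep : PairwiseIndependent p) where

    private
      c = p zero
      a = p (suc zero)
      xc = proj₁ c
      xa = proj₁ a
      s = det a c

      y : Fin (suc n) → Point
      y k = p (suc (suc k))

      C = product (det c ∘ y)
      A = product (det a ∘ y)

      s≢0 : s ≢ 0ℚ
      s≢0 = indep (suc zero) zero λ ()

      t fc fa : Fin (suc n) → ℚ
      t k  = proj₁ (y k) ^ suc n * inv (vandermonde p (suc (suc k)))
      fc k = proj₁ (y k) ^ n * inv (det (y k) c * vandermonde y k)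
      fa k = proj₁ (y k) ^ n * inv (det (y k) a * vandermonde y k)

    t≡ : ∀ k → t k ≡ (xa * inv s) * fa k + (- xc * inv s) * fc k
    t≡ k = begin
      x * xⁿ * inv (b * (b′ * V))
        ≡⟨ cong (λ w → x * xⁿ * w) (trans (cong inv (sym (*-assoc b b′ V))) (inv-distrib-* (b * b′) V)) ⟩
      x * xⁿ * (inv (b * b′) * inv V)
        ≡⟨ solve 4 (λ x xⁿ i j → x :* xⁿ :* (i :* j) := (x :* i) :* (xⁿ :* j)) refl x xⁿ (inv (b * b′)) (inv V) ⟩
      (x * inv (b * b′)) * (xⁿ * inv V)
        ≡⟨ cong (_* (xⁿ * inv V)) (partial-fractions {x} {xa} {xc} b≢0 b′≢0 s≢0 (plücker (y k) a c)) ⟩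
      inv s * (xa * inv b′ - xc * inv b) * (xⁿ * inv V)
        ≡⟨ solve 7 (λ xa xc xⁿ k i j l → k :* (xa :* j :- xc :* i) :* (xⁿ :* l)
                                         := (xa :* k) :* (xⁿ :* (j :* l)) :+ (:- xc :* k) :* (xⁿ :* (i :* l)))
                 refl xa xc xⁿ (inv s) (inv b) (inv b′) (inv V) ⟩
      (xa * inv s) * (xⁿ * (inv b′ * inv V)) + (- xc * inv s) * (xⁿ * (inv b * inv V))
        ≡⟨ cong₂ (λ α β → (xa * inv s) * (xⁿ * α) + (- xc * inv s) * (xⁿ * β))
                 (inv-distrib-* b′ V) (inv-distrib-* b V) ⟨
      (xa * inv s) * fa k + (- xc * inv s) * fc k
        ∎
      where
      x = proj₁ (y k)
      xⁿ = x ^ n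
      b = det (y k) c
      b′ = det (y k) a
      V = vandermonde y k
      b≢0 : b ≢ 0ℚ
      b≢0 = indep (suc (suc k)) zero λ ()
      b′≢0 : b′ ≢ 0ℚ
      b′≢0 = indep (suc (suc k)) (suc zero) λ ()

    sum-fc : sum fc ≡ - (xc ^ n * inv C)
    sum-fc = inverseʳ-unique _ _ (ih (removeAt p (suc zero)) (removeAt-independent {p = p} indep (suc zero)))

    sum-fa : sum fa ≡ - (xa ^ n * inv A)
    sum-fa = inverseʳ-unique _ _ (ih (removeAt p zero) (removeAt-independent {p = p} indep zero))

    sum-t : sum t ≡ (xa * inv s) * - (xa ^ n * inv A) + (- xc * inv s) * - (xc ^ n * inv C)
    sum-t = begin
      sum t                                                   ≡⟨ sum-cong-≗ t≡ ⟩
      sum (λ k → (xa * inv s) * fa k + (- xc * inv s) * fc k) ≡⟨ sum-linear (xa * inv s) (- xc * inv s) fa fc ⟩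
      (xa * inv s) * sum fa + (- xc * inv s) * sum fc
        ≡⟨ cong₂ (λ σ τ → (xa * inv s) * σ + (- xc * inv s) * τ) sum-fa sum-fc ⟩
      (xa * inv s) * - (xa ^ n * inv A) + (- xc * inv s) * - (xc ^ n * inv C)
        ∎

    inv[det[c,a]*C] : inv (det c a * C) ≡ - inv s * inv C
    inv[det[c,a]*C] = begin
      inv (det c a * C)      ≡⟨ inv-distrib-* (det c a) C ⟩
      inv (det c a) * inv C  ≡⟨ cong (λ w → inv w * inv C) (det-antisym a c) ⟩
      inv (- s) * inv C      ≡⟨ cong (_* inv C) (inv-neg s) ⟩
      - inv s * inv C        ∎

    step : sum (λ i → proj₁ (p i) ^ suc n * inv (vandermonde p i)) ≡ 0ℚ
    step = begin
      sum (λ i → proj₁ (p i) ^ suc n * inv (vandermonde p i))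
        ≡⟨⟩
      xc * xc ^ n * inv (det c a * C) + (xa * xa ^ n * inv (s * A) + sum t)
        ≡⟨ cong₂ (λ α β → xc * xc ^ n * α + (xa * xa ^ n * β + sum t)) inv[det[c,a]*C] (inv-distrib-* s A) ⟩
      xc * xc ^ n * (- inv s * inv C) + (xa * xa ^ n * (inv s * inv A) + sum t)
        ≡⟨ cong (λ w → xc * xc ^ n * (- inv s * inv C) + (xa * xa ^ n * (inv s * inv A) + w)) sum-t ⟩
      xc * xc ^ n * (- inv s * inv C) + (xa * xa ^ n * (inv s * inv A)
        + ((xa * inv s) * - (xa ^ n * inv A) + (- xc * inv s) * - (xc ^ n * inv C)))
        ≡⟨ solve 7 (λ xc xa xcⁿ xaⁿ k iA iC →
                      xc :* xcⁿ :* (:- k :* iC) :+ (xa :* xaⁿ :* (k :* iA)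
                        :+ ((xa :* k) :* (:- (xaⁿ :* iA)) :+ (:- xc :* k) :* (:- (xcⁿ :* iC)))) := con 0ℚ)
                 refl xc xa (xc ^ n) (xa ^ n) (inv s) (inv A) (inv C) ⟩
      0ℚ
        ∎

  ∑xⁿ/vandermonde≡0 : ∀ n (p : Fin (suc (suc n)) → Point) → PairwiseIndependent p →
                      sum (λ i → proj₁ (p i) ^ n * inv (vandermonde p i)) ≡ 0ℚ
  ∑xⁿ/vandermonde≡0 zero p _ = begin
    1ℚ * inv w + (1ℚ * inv (det b a * 1ℚ) + 0ℚ)  ≡⟨ cong (λ v → 1ℚ * inv w + (1ℚ * inv v + 0ℚ)) det[b,a]*1≡-w ⟩
    1ℚ * inv w + (1ℚ * inv (- w) + 0ℚ)           ≡⟨ cong (λ v → 1ℚ * inv w + (1ℚ * v + 0ℚ)) (inv-neg w) ⟩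
    1ℚ * inv w + (1ℚ * - inv w + 0ℚ)
      ≡⟨ solve 1 (λ i → con 1ℚ :* i :+ (con 1ℚ :* (:- i) :+ con 0ℚ) := con 0ℚ) refl (inv w) ⟩
    0ℚ                                            ∎
    where
    a = p zero
    b = p (suc zero)
    w = det a b * 1ℚ
    det[b,a]*1≡-w : det b a * 1ℚ ≡ - w
    det[b,a]*1≡-w = trans (cong (_* 1ℚ) (det-antisym a b)) (sym (neg-distribˡ-* (det a b) 1ℚ))

  ∑xⁿ/vandermonde≡0 (suc n) = LagrangeStep.step (∑xⁿ/vandermonde≡0 n)

  πrow : ∀ {n} → (Fin (suc n) → Point) → Fin (suc n) → ℚ
  πrow p i = proj₂ (p i) * vandermonde p i

  σrow : ∀ {n} → (Fin (suc n) → Point) → Fin (suc n) → ℚ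
  σrow p i = proj₂ (p i) + sum (removeAt (det (p i) ∘ p) i)

  1^n≡1 : ∀ n → 1ℚ ^ n ≡ 1ℚ
  1^n≡1 zero    = refl
  1^n≡1 (suc n) = trans (*-identityˡ (1ℚ ^ n)) (1^n≡1 n)

  -- ∑xⁿ/vandermonde≡0 for (1 , 0) ∷ p, where det (1 , 0) q = proj₂ q.
  ∑xⁿ/πrow≡1/∏y : ∀ n (p : Fin (suc n) → Point) → PairwiseIndependent p → (∀ i → proj₂ (p i) ≢ 0ℚ) →
                  sum (λ i → proj₁ (p i) ^ n * inv (πrow p i)) ≡ inv (product (proj₂ ∘ p))
  ∑xⁿ/πrow≡1/∏y n p indep y≢0 = begin
    sum t                                 ≡⟨ solve 1 (λ S → S := :- (:- con 1ℚ :* S)) refl (sum t) ⟩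
    - (- 1ℚ * sum t)                      ≡⟨ inverseˡ-unique _ _ lagrange ⟨
    1ℚ ^ n * inv (product (det e ∘ p))    ≡⟨ cong₂ (λ α β → α * inv β) (1^n≡1 n) (product-cong-≗ (det-e ∘ p)) ⟩
    1ℚ * inv (product (proj₂ ∘ p))        ≡⟨ *-identityˡ _ ⟩
    inv (product (proj₂ ∘ p))             ∎
    where
    t : Fin (suc n) → ℚ
    t i = proj₁ (p i) ^ n * inv (πrow p i)

    e : Point
    e = (1ℚ , 0ℚ)

    det-e : ∀ q → det e q ≡ proj₂ q
    det-e (x , y) = solve 2 (λ x y → con 1ℚ :* y :- x :* con 0ℚ := y) refl x y

    det-·-e : ∀ q → det q e ≡ - proj₂ q
    det-·-e q = trans (det-antisym e q) (cong -_ (det-e q))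

    flip-sign : ∀ i → - 1ℚ * t i ≡ proj₁ (p i) ^ n * inv (det (p i) e * vandermonde p i)
    flip-sign i = begin
      - 1ℚ * (X * inv (y * V))   ≡⟨ solve 2 (λ X j → :- con 1ℚ :* (X :* j) := X :* (:- j)) refl X (inv (y * V)) ⟩
      X * - inv (y * V)          ≡⟨ cong (X *_) (inv-neg (y * V)) ⟨
      X * inv (- (y * V))        ≡⟨ cong (λ w → X * inv w) (neg-distribˡ-* y V) ⟩
      X * inv (- y * V)          ≡⟨ cong (λ w → X * inv (w * V)) (det-·-e (p i)) ⟨
      X * inv (det (p i) e * V)  ∎
      where
      X = proj₁ (p i) ^ n
      y = proj₂ (p i)
      V = vandermonde p i

    lagrange : 1ℚ ^ n * inv (product (det e ∘ p)) + - 1ℚ * sum t ≡ 0ℚ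
    lagrange = trans (cong (_+_ (1ℚ ^ n * inv (product (det e ∘ p))))
                           (trans (*-distribˡ-sum (- 1ℚ) t) (sum-cong-≗ flip-sign)))
                     (∑xⁿ/vandermonde≡0 n (e ∷ p) (∷-independent (λ j → y≢0 j ∘ trans (sym (det-e (p j)))) indep))

  det-self : ∀ q → det q q ≡ 0ℚ
  det-self (x , y) = solve 2 (λ x y → x :* y :- x :* y := con 0ℚ) refl x y

  sum-det : ∀ {n} q (r : Fin n → Point) → sum (det q ∘ r) ≡ proj₁ q * sum (proj₂ ∘ r) + - proj₂ q * sum (proj₁ ∘ r)
  sum-det (x , y) r = trans (sum-cong-≗ (λ j → det-as-sum (proj₁ (r j)) (proj₂ (r j))))
                            (sum-linear x (- y) (proj₂ ∘ r) (proj₁ ∘ r))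
    where
    det-as-sum : ∀ x′ y′ → det (x , y) (x′ , y′) ≡ x * y′ + - y * x′
    det-as-sum x′ y′ = solve 4 (λ x y x′ y′ → x :* y′ :- x′ :* y := x :* y′ :+ :- y :* x′) refl x y x′ y′

  σrow≡ : ∀ {n} (p : Fin (suc n) → Point) i →
          σrow p i ≡ proj₂ (p i) + (proj₁ (p i) * sum (proj₂ ∘ p) + - proj₂ (p i) * sum (proj₁ ∘ p))
  σrow≡ p i = cong (_+_ (proj₂ (p i))) (begin
    sum (removeAt (det (p i) ∘ p) i)                   ≡⟨ +-identityˡ _ ⟨
    0ℚ + sum (removeAt (det (p i) ∘ p) i)              ≡⟨ cong (_+ sum (removeAt (det (p i) ∘ p) i)) (det-self (p i)) ⟨
    det (p i) (p i) + sum (removeAt (det (p i) ∘ p) i) ≡⟨ sum-remove (det (p i) ∘ p) ⟨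
    sum (det (p i) ∘ p)                                ≡⟨ sum-det (p i) p ⟩
    proj₁ (p i) * sum (proj₂ ∘ p) + - proj₂ (p i) * sum (proj₁ ∘ p) ∎)

  ∑xⁿσrow/πrow≡∑y/∏y : ∀ n (p : Fin (suc (suc n)) → Point) → PairwiseIndependent p → (∀ i → proj₂ (p i) ≢ 0ℚ) →
                       sum (λ i → proj₁ (p i) ^ n * σrow p i * inv (πrow p i))
                       ≡ sum (proj₂ ∘ p) * inv (product (proj₂ ∘ p))
  ∑xⁿσrow/πrow≡∑y/∏y n p indep y≢0 = begin
    sum (λ i → proj₁ (p i) ^ n * σrow p i * inv (πrow p i))  ≡⟨ sum-cong-≗ split ⟩
    sum (λ i → Y * u i + (1ℚ - X) * v i)                      ≡⟨ sum-linear Y (1ℚ - X) u v ⟩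
    Y * sum u + (1ℚ - X) * sum v
      ≡⟨ cong₂ (λ α β → Y * α + (1ℚ - X) * β) (∑xⁿ/πrow≡1/∏y (suc n) p indep y≢0) (∑xⁿ/vandermonde≡0 n p indep) ⟩
    Y * inv (product (proj₂ ∘ p)) + (1ℚ - X) * 0ℚ
      ≡⟨ solve 3 (λ Y X i → Y :* i :+ (con 1ℚ :- X) :* con 0ℚ := Y :* i) refl Y X (inv (product (proj₂ ∘ p))) ⟩
    Y * inv (product (proj₂ ∘ p))                             ∎
    where
    X = sum (proj₁ ∘ p)
    Y = sum (proj₂ ∘ p)

    u v : Fin (suc (suc n)) → ℚ
    u i = proj₁ (p i) ^ suc n * inv (πrow p i)
    v i = proj₁ (p i) ^ n * inv (vandermonde p i)

    split : ∀ i → proj₁ (p i) ^ n * σrow p i * inv (πrow p i) ≡ Y * u i + (1ℚ - X) * v i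
    split i = begin
      xⁿ * σrow p i * inv (y * V)
        ≡⟨ cong₂ (λ σ w → xⁿ * σ * w) (σrow≡ p i) (inv-distrib-* y V) ⟩
      xⁿ * (y + (x * Y + - y * X)) * (inv y * inv V)
        ≡⟨ solve 7 (λ x y xⁿ X Y j k → xⁿ :* (y :+ (x :* Y :+ :- y :* X)) :* (j :* k)
                                       := Y :* (x :* xⁿ :* (j :* k)) :+ (con 1ℚ :- X) :* (xⁿ :* k) :* (y :* j))
                 refl x y xⁿ X Y (inv y) (inv V) ⟩
      Y * (x * xⁿ * (inv y * inv V)) + (1ℚ - X) * (xⁿ * inv V) * (y * inv y)
        ≡⟨ cong₂ (λ w u → Y * (x * xⁿ * w) + (1ℚ - X) * (xⁿ * inv V) * u)
                 (sym (inv-distrib-* y V)) (inv-inverseʳ (y≢0 i)) ⟩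
      Y * (x * xⁿ * inv (y * V)) + (1ℚ - X) * (xⁿ * inv V) * 1ℚ
        ≡⟨ cong (_+_ (Y * (x * xⁿ * inv (y * V)))) (*-identityʳ _) ⟩
      Y * (x * xⁿ * inv (y * V)) + (1ℚ - X) * (xⁿ * inv V) ∎
      where
      x = proj₁ (p i)
      y = proj₂ (p i)
      xⁿ = x ^ n
      V = vandermonde p i

  positive⇒≢0 : ∀ {q} → Positive q → q ≢ 0ℚ
  positive⇒≢0 {q} q>0 q≡0 = <⇒≢ (positive⁻¹ q {{q>0}}) (sym q≡0)

  toℚ-positive : ∀ {k} → 0 ℕ.< k → Positive (toℚ (+ k))
  toℚ-positive {suc k} _ = subst Positive (sym (toℚ≡mkℚ (+ suc k))) _

  sum-positive : ∀ {n} (f : Fin (suc n) → ℚ) → (∀ i → Positive (f i)) → Positive (sum f)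
  sum-positive {zero}  f f>0 = pos+nonNeg⇒pos (f zero) {{f>0 zero}} 0ℚ
  sum-positive {suc n} f f>0 = pos+pos⇒pos (f zero) {{f>0 zero}} (sum (f ∘ suc)) {{sum-positive (f ∘ suc) (f>0 ∘ suc)}}

  product-positive : ∀ {n} (f : Fin n → ℚ) → (∀ i → Positive (f i)) → Positive (product f)
  product-positive {zero}  f f>0 = _
  product-positive {suc n} f f>0 =
    pos*pos⇒pos (f zero) {{f>0 zero}} (product (f ∘ suc)) {{product-positive (f ∘ suc) (f>0 ∘ suc)}}

  module _ {n} (d δ : Fin (suc n) → ℕ) where

    point : Fin (suc n) → Point
    point i = (toℚ (+ δ i) , toℚ (+ d i))

    dRow-diag : ∀ i → dRow d δ i i ≡ + d i
    dRow-diag i with i Fin.≟ i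
    ... | yes _   = refl
    ... | no i≢i  = contradiction refl i≢i

    dRow-offdiag : ∀ {i j} → i ≢ j → dRow d δ i j ≡ + (δ i ℕ.* d j) ℤ.- + (δ j ℕ.* d i)
    dRow-offdiag {i} {j} i≢j with i Fin.≟ j
    ... | yes i≡j = contradiction i≡j i≢j
    ... | no _    = refl

    det-point : ∀ i j → det (point i) (point j) ≡ toℚ (+ (δ i ℕ.* d j) ℤ.- + (δ j ℕ.* d i))
    det-point i j = sym (trans (toℚ-- (+ (δ i ℕ.* d j)) (+ (δ j ℕ.* d i)))
                               (cong₂ _-_ (toℚ-+* (δ i) (d j)) (toℚ-+* (δ j) (d i))))

    point-independent : (∀ i j → i ≢ j → δ i ℕ.* d j ≢ δ j ℕ.* d i) → PairwiseIndependent point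
    point-independent δd≢δd i j i≢j det≡0 =
      δd≢δd i j i≢j (ℤ.+-injective (ℤ.i-j≡0⇒i≡j _ _ (toℚ-injective (trans (sym (det-point i j)) det≡0))))

    toℚ-dRow-removeAt : ∀ i j → toℚ (removeAt (dRow d δ i) i j) ≡ removeAt (det (point i) ∘ point) i j
    toℚ-dRow-removeAt i j = trans (cong toℚ (dRow-offdiag (punchInᵢ≢i i j ∘ sym))) (sym (det-point i (punchIn i j)))

    toℚ-π-dRow : ∀ i → toℚ (π (dRow d δ i)) ≡ πrow point i
    toℚ-π-dRow i = begin
      toℚ (prodℤ (dRow d δ i))                                       ≡⟨ toℚ-prodℤ (dRow d δ i) ⟩
      product (toℚ ∘ dRow d δ i)                                     ≡⟨ product-remove {i = i} (toℚ ∘ dRow d δ i) ⟩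
      toℚ (dRow d δ i i) * product (removeAt (toℚ ∘ dRow d δ i) i)
        ≡⟨ cong₂ _*_ (cong toℚ (dRow-diag i)) (product-cong-≗ (toℚ-dRow-removeAt i)) ⟩
      πrow point i                                                   ∎

    toℚ-σ₁-dRow : ∀ i → toℚ (σ₁ (dRow d δ i)) ≡ σrow point i
    toℚ-σ₁-dRow i = begin
      toℚ (sumℤ (dRow d δ i))                                ≡⟨ toℚ-sumℤ (dRow d δ i) ⟩
      sum (toℚ ∘ dRow d δ i)                                 ≡⟨ sum-remove {i = i} (toℚ ∘ dRow d δ i) ⟩
      toℚ (dRow d δ i i) + sum (removeAt (toℚ ∘ dRow d δ i) i)
        ≡⟨ cong₂ _+_ (cong toℚ (dRow-diag i)) (sum-cong-≗ (toℚ-dRow-removeAt i)) ⟩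
      σrow point i                                           ∎

  module _ {n} (d δ : Fin (suc (suc n)) → ℕ) (d>0 : ∀ i → 0 ℕ.< d i)
           (δd≢δd : ∀ i j → i ≢ j → δ i ℕ.* d j ≢ δ j ℕ.* d i) where

    private
      p = point d δ
      P = product (proj₂ ∘ p)
      Y = sum (proj₂ ∘ p)

      indep : PairwiseIndependent p
      indep = point-independent d δ δd≢δd

      y>0 : ∀ i → Positive (proj₂ (p i))
      y>0 = toℚ-positive ∘ d>0

      y≢0 : ∀ i → proj₂ (p i) ≢ 0ℚ
      y≢0 = positive⇒≢0 ∘ y>0

      P≢0 : P ≢ 0ℚ
      P≢0 = positive⇒≢0 (product-positive (proj₂ ∘ p) y>0)

      Y≢0 : Y ≢ 0ℚ
      Y≢0 = positive⇒≢0 (sum-positive (proj₂ ∘ p) y>0)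

    first-identity : toℚ (π (λ i → + d i)) * sumℚ (λ i → toℚ (+ (δ i ℕ.^ suc n)) * inv (toℚ (π (dRow d δ i))))
                     ≡ 1ℚ
    first-identity = begin
      toℚ (π (λ i → + d i)) * sumℚ (λ i → toℚ (+ (δ i ℕ.^ suc n)) * inv (toℚ (π (dRow d δ i))))
        ≡⟨ cong₂ _*_ (toℚ-prodℤ (λ i → + d i)) (sumℚ≡sum-cong λ i →
             cong₂ (λ a b → a * inv b) (toℚ-+^ (δ i) (suc n)) (toℚ-π-dRow d δ i)) ⟩
      P * sum (λ i → proj₁ (p i) ^ suc n * inv (πrow p i))  ≡⟨ cong (P *_) (∑xⁿ/πrow≡1/∏y (suc n) p indep y≢0) ⟩
      P * inv P                                             ≡⟨ inv-inverseʳ P≢0 ⟩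
      1ℚ                                                    ∎

    second-identity : (toℚ (π (λ i → + d i)) * inv (toℚ (σ₁ (λ i → + d i))))
                      * sumℚ (λ i → (toℚ (+ (δ i ℕ.^ n)) * toℚ (σ₁ (dRow d δ i))) * inv (toℚ (π (dRow d δ i))))
                      ≡ 1ℚ
    second-identity = begin
      (toℚ (π (λ i → + d i)) * inv (toℚ (σ₁ (λ i → + d i))))
        * sumℚ (λ i → (toℚ (+ (δ i ℕ.^ n)) * toℚ (σ₁ (dRow d δ i))) * inv (toℚ (π (dRow d δ i))))
        ≡⟨ cong₂ _*_ (cong₂ (λ a b → a * inv b) (toℚ-prodℤ (λ i → + d i)) (toℚ-sumℤ (λ i → + d i)))
                     (sumℚ≡sum-cong λ i → cong₂ (λ a b → a * inv b)
                                                (cong₂ _*_ (toℚ-+^ (δ i) n) (toℚ-σ₁-dRow d δ i))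
                                                (toℚ-π-dRow d δ i)) ⟩
      (P * inv Y) * sum (λ i → proj₁ (p i) ^ n * σrow p i * inv (πrow p i))
        ≡⟨ cong ((P * inv Y) *_) (∑xⁿσrow/πrow≡∑y/∏y n p indep y≢0) ⟩
      (P * inv Y) * (Y * inv P)
        ≡⟨ solve 4 (λ P Y i j → (P :* j) :* (Y :* i) := (P :* i) :* (Y :* j)) refl P Y (inv P) (inv Y) ⟩
      (P * inv P) * (Y * inv Y)                             ≡⟨ cong₂ _*_ (inv-inverseʳ P≢0) (inv-inverseʳ Y≢0) ⟩
      1ℚ                                                    ∎

open import Data.Nat using (ℕ; _≤_; _<_; _∸_; _^_; _*_; suc; s≤s; z≤n)
open import Data.Nat.GCD using (gcd)
open import Data.Integer using (+_)
open import Data.Rational using (ℚ; 1ℚ) renaming (_*_ to _*ℚ_)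
open import Data.Fin using (Fin)
open import Data.Product using (_×_; _,_)
open import Relation.Binary.PropositionalEquality using (_≡_; _≢_)
open Lagrange using (first-identity; second-identity)

mainTheorem4 : (m : ℕ) → 2 ≤ m → (d δ : Fin m → ℕ)
    → (∀ i → 0 < d i) → (∀ i → 0 < δ i)
    → (∀ i → gcd (δ i) (d i) ≡ 1)
    → (∀ i j → i ≢ j → δ i * d j ≢ δ j * d i)
    → (toℚ (π (λ i → + d i)) *ℚ
         sumℚ (λ i → toℚ (+ (δ i ^ (m ∸ 1))) *ℚ inv (toℚ (π (dRow d δ i))))
         ≡ 1ℚ)
      × ((toℚ (π (λ i → + d i)) *ℚ inv (toℚ (σ₁ (λ i → + d i))))
         *ℚ sumℚ (λ i → (toℚ (+ (δ i ^ (m ∸ 2))) *ℚ toℚ (σ₁ (dRow d δ i)))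
                           *ℚ inv (toℚ (π (dRow d δ i))))
         ≡ 1ℚ)
mainTheorem4 (suc (suc n)) (s≤s (s≤s z≤n)) d δ d>0 _ _ δd≢δd =
  first-identity d δ d>0 δd≢δd , second-identity d δ d>0 δd≢δd
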